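{- Let $G$ be a finite tree. Then for every $\phi \in \operatorname{End}(G)\setminus\operatorname{Aut}(G)$ there exist two vertices $x, y$ of $G$ at distance $2$ such that $\phi(x) = \phi(y)$.
   Context: An endomorphism of a simple graph $G=(V,E)$ is a map $\phi: V\to V$ such that $\phi(u)\phi(v)\in E$ whenever $uv\in E$; $\operatorname{End}(G)$ is the set of endomorphisms and $\operatorname{Aut}(G)$ the set of automorphisms. -}

module Defs where

open import Data.Nat using (ℕ; zero; suc; _≤_; _<_)
import Data.Nat as ℕ
open import Data.Fin using (Fin; zero; suc; inject₁; fromℕ)
open import Data.Product using (Σ; ∃; ∃-syntax; _×_; _,_)
open import Relation.Nullary using (¬_)
open import Relation.Binary.PropositionalEquality using (_≡_)
open import Function.Definitions using (Injective)

record SimpleGraph (n : ℕ) : Set₁ where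
  field
    Adj     : Fin n → Fin n → Set
    sym     : ∀ {u v} → Adj u v → Adj v u
    irrefl  : ∀ {u} → ¬ Adj u u

module _ {n : ℕ} (G : SimpleGraph n) where
  open SimpleGraph G

  data Walk : Fin n → Fin n → ℕ → Set where
    nil  : ∀ {u} → Walk u u zero
    cons : ∀ {u v w k} → Adj u v → Walk v w k → Walk u w (suc k)

  Connected : Set
  Connected = ∀ x y → ∃[ k ] Walk x y k

  HasCycle : Set
  HasCycle = ∃[ m ] (2 ≤ m × Σ (Fin (ℕ.suc m) → Fin n) λ c →
               Injective _≡_ _≡_ c
             × (∀ (i : Fin m) → Adj (c (inject₁ i)) (c (suc i)))
             × Adj (c (fromℕ m)) (c zero))

  IsTree : Set
  IsTree = Connected × ¬ HasCycle

  Dist2 : Fin n → Fin n → Set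
  Dist2 x y = Walk x y 2 × (∀ k → k < 2 → ¬ Walk x y k)

  IsEndomorphism : (Fin n → Fin n) → Set
  IsEndomorphism φ = ∀ u v → Adj u v → Adj (φ u) (φ v)

  IsAutomorphism : (Fin n → Fin n) → Set
  IsAutomorphism φ = IsEndomorphism φ × Σ (Fin n → Fin n) λ ψ →
    IsEndomorphism ψ × (∀ v → ψ (φ v) ≡ v) × (∀ v → φ (ψ v) ≡ v)

-- In a tree, a walk that never immediately retraces an edge is a path (it
-- repeats no vertex); every walk reduces to such a walk with the same ends.
-- If φ identifies x ≠ y, take that reduced walk from x to y: its image under φ
-- is a walk that returns to its start, so it must backtrack at some step,
-- i.e. φ identifies the two ends of a two-step subpath, and those ends are at
-- distance 2 since a tree has no triangles. If φ is injective, it permutes the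
-- finitely many vertices, and its inverse preserves adjacency: the image of the
-- reduced walk between the preimages of two adjacent vertices is a path
-- between them, which in a tree can only be the edge itself.
module Submission where

open import Defs
open import Data.Nat using (ℕ; zero; suc; _+_; _≤_; _<_; _≤?_; z≤n; s≤s)
open import Data.Nat.Properties using (≤-refl; ≤-trans; ≤-pred; n≤1+n; n<1+n; anyUpTo?)
open import Data.Nat.Induction using (<-rec)
open import Data.Fin as Fin using (Fin; toℕ; inject₁; punchOut)
open import Data.Fin.Properties
  using (_≟_; any?; pigeonhole; punchOut-injective; <⇒≢; toℕ-injective; toℕ-fromℕ; toℕ-inject₁; toℕ<n)
open import Data.Product using (∃; ∃-syntax; _×_; _,_; proj₁; proj₂)
open import Data.Sum using (_⊎_; inj₁; inj₂)
open import Data.Empty using (⊥-elim)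
open import Function using (_∘_)
open import Function.Definitions using (Injective)
open import Relation.Nullary using (¬_; yes; no; contradiction)
open import Relation.Nullary.Decidable using (_×-dec_; ¬?)
open import Relation.Binary.PropositionalEquality
  using (_≡_; _≢_; refl; sym; cong; subst; subst₂)

module _ {a} {A : Set a} where

  InjectiveUpTo : (ℕ → A) → ℕ → Set a
  InjectiveUpTo q k = ∀ {i j} → i ≤ k → j ≤ k → q i ≡ q j → i ≡ j

  injectiveUpTo-zero : ∀ {q} → InjectiveUpTo q 0
  injectiveUpTo-zero z≤n z≤n _ = refl

  injectiveUpTo-mono : ∀ {q m k} → m ≤ k → InjectiveUpTo q k → InjectiveUpTo q m
  injectiveUpTo-mono m≤k inj i≤m j≤m = inj (≤-trans i≤m m≤k) (≤-trans j≤m m≤k)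

  injectiveUpTo-cons : ∀ {q m} → InjectiveUpTo (q ∘ suc) m →
                       (∀ {s} → s ≤ m → q 0 ≢ q (suc s)) → InjectiveUpTo q (suc m)
  injectiveUpTo-cons tail fresh {zero}  {zero}  _         _         _  = refl
  injectiveUpTo-cons tail fresh {zero}  {suc j} _         (s≤s j≤m) eq = ⊥-elim (fresh j≤m eq)
  injectiveUpTo-cons tail fresh {suc i} {zero}  (s≤s i≤m) _         eq = ⊥-elim (fresh i≤m (sym eq))
  injectiveUpTo-cons tail fresh {suc i} {suc j} (s≤s i≤m) (s≤s j≤m) eq = cong suc (tail i≤m j≤m eq)

module _ {n m : ℕ} where

  collision⊎injective : (f : Fin n → Fin m) →
                        (∃[ x ] ∃[ y ] (x ≢ y × f x ≡ f y)) ⊎ Injective _≡_ _≡_ f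
  collision⊎injective f with any? (λ x → any? (λ y → ¬? (x ≟ y) ×-dec (f x ≟ f y)))
  ... | yes collision = inj₁ collision
  ... | no noCollision = inj₂ injective
    where
    injective : Injective _≡_ _≡_ f
    injective {x} {y} fx≡fy with x ≟ y
    ... | yes x≡y = x≡y
    ... | no  x≢y = contradiction (x , y , x≢y , fx≡fy) noCollision

injective⇒surjective : ∀ {n} {f : Fin n → Fin n} → Injective _≡_ _≡_ f → ∀ y → ∃ λ x → f x ≡ y
injective⇒surjective {zero}          _   ()
injective⇒surjective {suc n} {f} inj y with any? (λ x → f x ≟ y)
... | yes hit  = hit
... | no  miss =
  let i , j , i<j , pᵢ≡pⱼ = pigeonhole (n<1+n n) (λ x → punchOut (avoids x))
  in contradiction (inj (punchOut-injective (avoids i) (avoids j) pᵢ≡pⱼ)) (<⇒≢ i<j)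
  where
  avoids : ∀ x → y ≢ f x
  avoids x y≡fx = miss (x , sym y≡fx)

module _ {n : ℕ} (G : SimpleGraph n) where
  open SimpleGraph G renaming (sym to Adj-sym)

  -- A walk of length k is encoded by its vertices q 0, …, q k; later values are ignored.
  IsWalkSeq : (ℕ → Fin n) → ℕ → Set
  IsWalkSeq q k = ∀ {i} → i < k → Adj (q i) (q (suc i))

  NonBacktracking : (ℕ → Fin n) → ℕ → Set
  NonBacktracking q k = ∀ {i} → 2 + i ≤ k → q i ≢ q (2 + i)

  closedPath⇒cycle : ∀ {q m} → 2 ≤ m → IsWalkSeq q m → InjectiveUpTo q m →
                     Adj (q m) (q 0) → HasCycle G
  closedPath⇒cycle {q} {m} 2≤m walk inj closing =
    m , 2≤m , c , c-injective , c-steps , subst (λ i → Adj (q i) (q 0)) (sym (toℕ-fromℕ m)) closing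
    where
    c : Fin (suc m) → Fin n
    c = q ∘ toℕ
    c-injective : Injective _≡_ _≡_ c
    c-injective {a} {b} = toℕ-injective ∘ inj (≤-pred (toℕ<n a)) (≤-pred (toℕ<n b))
    c-steps : ∀ (i : Fin m) → Adj (c (inject₁ i)) (c (Fin.suc i))
    c-steps i rewrite toℕ-inject₁ i = walk (toℕ<n i)

  record NonBacktrackingWalk (u v : Fin n) : Set where
    constructor mkNBWalk
    field
      length          : ℕ
      vertex          : ℕ → Fin n
      starts          : vertex 0 ≡ u
      ends            : vertex length ≡ v
      isWalk          : IsWalkSeq vertex length
      nonBacktracking : NonBacktracking vertex length

  infixr 5 _◂_
  _◂_ : Fin n → (ℕ → Fin n) → ℕ → Fin n
  (u ◂ q) zero    = u
  (u ◂ q) (suc i) = q i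

  ◂-isWalkSeq : ∀ {u q k} → Adj u (q 0) → IsWalkSeq q k → IsWalkSeq (u ◂ q) (suc k)
  ◂-isWalkSeq u~q₀ walk {zero}  _         = u~q₀
  ◂-isWalkSeq u~q₀ walk {suc i} (s≤s i<k) = walk i<k

  -- Prepending a step that the walk immediately retraces cancels both.
  prepend : ∀ {u w v} → Adj u w → NonBacktrackingWalk w v → NonBacktrackingWalk u v
  prepend {u} u~w (mkNBWalk zero q refl q₀≡v walk _) =
    mkNBWalk 1 (u ◂ q) refl q₀≡v (◂-isWalkSeq u~w walk) λ { (s≤s ()) }
  prepend {u} u~w (mkNBWalk (suc k) q refl end walk nb) with q 1 ≟ u
  ... | yes q₁≡u = mkNBWalk k (q ∘ suc) q₁≡u end (walk ∘ s≤s) (nb ∘ s≤s)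
  ... | no  q₁≢u = mkNBWalk (suc (suc k)) (u ◂ q) refl end (◂-isWalkSeq u~w walk) nb′
    where
    nb′ : NonBacktracking (u ◂ q) (suc (suc k))
    nb′ {zero}  _          = q₁≢u ∘ sym
    nb′ {suc i} (s≤s 2+i≤) = nb 2+i≤

  reduce : ∀ {u v k} → Walk G u v k → NonBacktrackingWalk u v
  reduce {u} nil            = mkNBWalk 0 (λ _ → u) refl refl (λ ()) (λ ())
  reduce     (cons u~w walk) = prepend u~w (reduce walk)

  nonBacktrackingWalk : Connected G → ∀ u v → NonBacktrackingWalk u v
  nonBacktrackingWalk connected u v = reduce (proj₂ (connected u v))

  map-isWalkSeq : ∀ {φ q k} → IsEndomorphism G φ → IsWalkSeq q k → IsWalkSeq (φ ∘ q) k
  map-isWalkSeq endo walk i<k = endo _ _ (walk i<k)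

  module _ (acyclic : ¬ HasCycle G) where

    nonBacktracking⇒injectiveUpTo : ∀ k {q} → IsWalkSeq q k → NonBacktracking q k → InjectiveUpTo q k
    nonBacktracking⇒injectiveUpTo zero    _    _  = injectiveUpTo-zero
    nonBacktracking⇒injectiveUpTo (suc k) {q} walk nb = injectiveUpTo-cons tail (<-rec _ headFresh _)
      where
      tail : InjectiveUpTo (q ∘ suc) k
      tail = nonBacktracking⇒injectiveUpTo k (walk ∘ s≤s) (nb ∘ s≤s)
      -- A first return to q 0 after t + 1 ≥ 3 steps closes a cycle q 0, …, q t.
      headFresh : ∀ t → (∀ {s} → s < t → s ≤ k → q 0 ≢ q (suc s)) → t ≤ k → q 0 ≢ q (suc t)
      headFresh zero       _ _   q₀≡q₁ = irrefl (subst (Adj (q 0)) (sym q₀≡q₁) (walk (s≤s z≤n)))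
      headFresh (suc zero) _ 1≤k = nb (s≤s 1≤k)
      headFresh t@(suc t′@(suc _)) earlier t≤k q₀≡qₜ₊₁ =
        acyclic (closedPath⇒cycle (s≤s (s≤s z≤n)) walkUpToT injectiveUpToT closing)
        where
        t′≤k : t′ ≤ k
        t′≤k = ≤-trans (n≤1+n t′) t≤k
        walkUpToT : IsWalkSeq q t
        walkUpToT i<t = walk (≤-trans i<t (≤-trans t≤k (n≤1+n k)))
        injectiveUpToT : InjectiveUpTo q t
        injectiveUpToT = injectiveUpTo-cons (injectiveUpTo-mono t′≤k tail)
                           (λ s≤t′ → earlier (s≤s s≤t′) (≤-trans s≤t′ t′≤k))
        closing : Adj (q t) (q 0)
        closing = subst (Adj (q t)) (sym q₀≡qₜ₊₁) (walk (s≤s t≤k))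

    twoStep⇒dist2 : ∀ {a b c} → Adj a b → Adj b c → a ≢ c → Dist2 G a c
    twoStep⇒dist2 {a} {b} {c} a~b b~c a≢c = cons a~b (cons b~c nil) , noShorterWalk
      where
      walk : IsWalkSeq (a ◂ b ◂ λ _ → c) 2
      walk (s≤s z≤n)       = a~b
      walk (s≤s (s≤s z≤n)) = b~c
      noShorterWalk : ∀ k → k < 2 → ¬ Walk G a c k
      noShorterWalk zero          _ nil            = a≢c refl
      noShorterWalk (suc zero)    _ (cons a~c nil) =
        acyclic (closedPath⇒cycle ≤-refl walk
                   (nonBacktracking⇒injectiveUpTo 2 walk λ { (s≤s (s≤s z≤n)) → a≢c })
                   (Adj-sym a~c))
      noShorterWalk (suc (suc _)) (s≤s (s≤s ()))

    -- φ ∘ q returns to its start, so it cannot be non-backtracking.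
    nonInjectiveEndomorphism⇒collapsesDist2 :
      ∀ {φ} → IsEndomorphism G φ → ∀ {x y} → NonBacktrackingWalk x y → x ≢ y → φ x ≡ φ y →
      ∃[ a ] ∃[ b ] (Dist2 G a b × φ a ≡ φ b)
    nonInjectiveEndomorphism⇒collapsesDist2 {φ} endo (mkNBWalk ℓ q refl refl walk nb) q₀≢qℓ φq₀≡φqℓ
      with anyUpTo? (λ t → (2 + t ≤? ℓ) ×-dec (φ (q t) ≟ φ (q (2 + t)))) ℓ
    ... | yes (t , _ , 2+t≤ℓ , φqₜ≡φqₜ₊₂) =
      q t , q (2 + t) , twoStep⇒dist2 (walk (≤-trans (n≤1+n _) 2+t≤ℓ)) (walk 2+t≤ℓ) (nb 2+t≤ℓ) , φqₜ≡φqₜ₊₂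
    ... | no noBacktrack = contradiction (cong q 0≡ℓ) q₀≢qℓ
      where
      φq-nonBacktracking : NonBacktracking (φ ∘ q) ℓ
      φq-nonBacktracking {t} 2+t≤ℓ φqₜ≡φqₜ₊₂ =
        noBacktrack (t , ≤-trans (n≤1+n _) 2+t≤ℓ , 2+t≤ℓ , φqₜ≡φqₜ₊₂)
      0≡ℓ : 0 ≡ ℓ
      0≡ℓ = nonBacktracking⇒injectiveUpTo ℓ (map-isWalkSeq endo walk) φq-nonBacktracking
              z≤n ≤-refl φq₀≡φqℓ

    injectiveEndomorphism-reflects-Adj :
      ∀ {φ} → IsEndomorphism G φ → Injective _≡_ _≡_ φ →
      ∀ {x y} → NonBacktrackingWalk x y → Adj (φ x) (φ y) → Adj x y
    injectiveEndomorphism-reflects-Adj endo inj (mkNBWalk zero q refl refl _ _) φx~φy =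
      ⊥-elim (irrefl φx~φy)
    injectiveEndomorphism-reflects-Adj endo inj (mkNBWalk (suc zero) q refl refl walk _) _ =
      walk (s≤s z≤n)
    injectiveEndomorphism-reflects-Adj {φ} endo inj (mkNBWalk ℓ@(suc (suc _)) q refl refl walk nb) φx~φy =
      ⊥-elim (acyclic (closedPath⇒cycle (s≤s (s≤s z≤n)) φq-walk
                         (nonBacktracking⇒injectiveUpTo ℓ φq-walk (λ 2+t≤ℓ → nb 2+t≤ℓ ∘ inj))
                         (Adj-sym φx~φy)))
      where
      φq-walk : IsWalkSeq (φ ∘ q) ℓ
      φq-walk = map-isWalkSeq endo walk

    injectiveEndomorphism⇒automorphism :
      Connected G → ∀ {φ} → IsEndomorphism G φ → Injective _≡_ _≡_ φ → IsAutomorphism G φ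
    injectiveEndomorphism⇒automorphism connected {φ} endo inj = endo , ψ , ψ-endo , ψ∘φ , φ∘ψ
      where
      ψ : Fin n → Fin n
      ψ = proj₁ ∘ injective⇒surjective inj
      φ∘ψ : ∀ v → φ (ψ v) ≡ v
      φ∘ψ = proj₂ ∘ injective⇒surjective inj
      ψ∘φ : ∀ v → ψ (φ v) ≡ v
      ψ∘φ = inj ∘ φ∘ψ ∘ φ
      ψ-endo : IsEndomorphism G ψ
      ψ-endo u v u~v = injectiveEndomorphism-reflects-Adj endo inj (nonBacktrackingWalk connected (ψ u) (ψ v))
                         (subst₂ Adj (sym (φ∘ψ u)) (sym (φ∘ψ v)) u~v)

corollary10 : (n : ℕ) (G : SimpleGraph n) → IsTree G →
    (φ : Fin n → Fin n) → IsEndomorphism G φ → ¬ IsAutomorphism G φ →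
    ∃[ x ] ∃[ y ] (Dist2 G x y × φ x ≡ φ y)
corollary10 n G (connected , acyclic) φ endo notAutomorphism with collision⊎injective φ
... | inj₁ (x , y , x≢y , φx≡φy) =
  nonInjectiveEndomorphism⇒collapsesDist2 G acyclic endo (nonBacktrackingWalk G connected x y) x≢y φx≡φy
... | inj₂ injective =
  contradiction (injectiveEndomorphism⇒automorphism G acyclic connected endo injective) notAutomorphism
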